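{- Let $G$ be a countably infinite HH-homogeneous graph. If $G$ contains a vertex of infinite degree, then all vertices of $G$ have infinite degree.
   Context: Graphs are simple. A homomorphism maps edges to edges; an endomorphism of $G$ is a homomorphism $G\to G$. $G$ is HH-homogeneous if every homomorphism between finite induced subgraphs of $G$ extends to an endomorphism of $G$. -}

module Defs where

open import Data.Nat using (ℕ)
open import Data.Fin using (Fin)
open import Data.List using (List)
open import Data.List.Membership.Propositional using (_∈_)
open import Data.Product using (∃; Σ; _×_)
open import Function.Definitions using (Injective)
open import Relation.Binary.PropositionalEquality using (_≡_)
open import Relation.Nullary using (¬_)
open import Level using (0ℓ; suc)

-- A simple graph on the countably infinite vertex set ℕ.
record Graph : Set₁ where
  field
    E      : ℕ → ℕ → Set
    sym    : ∀ {x y} → E x y → E y x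
    irrefl : ∀ {x} → ¬ E x x
open Graph public

IsEndomorphism : (G : Graph) → (ℕ → ℕ) → Set
IsEndomorphism G F = ∀ x y → E G x y → E G (F x) (F y)

-- A finite induced subgraph of G is given by a finite set of vertices,
-- enumerated injectively by a : Fin n → ℕ.
IsFinHom : (G : Graph) {n m : ℕ} → (Fin n → ℕ) → (Fin m → ℕ) → (Fin n → Fin m) → Set
IsFinHom G a b h = ∀ i j → E G (a i) (a j) → E G (b (h i)) (b (h j))

HH-homogeneous : Graph → Set
HH-homogeneous G =
  ∀ (n m : ℕ) (a : Fin n → ℕ) (b : Fin m → ℕ) →
  Injective _≡_ _≡_ a → Injective _≡_ _≡_ b →
  (h : Fin n → Fin m) → IsFinHom G a b h →
  Σ (ℕ → ℕ) λ F → IsEndomorphism G F × (∀ i → F (a i) ≡ b (h i))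

FiniteDegree : Graph → ℕ → Set
FiniteDegree G x = ∃ λ (l : List ℕ) → ∀ y → E G x y → y ∈ l

InfiniteDegree : Graph → ℕ → Set
InfiniteDegree G x = ¬ FiniteDegree G x

-- Suppose v has infinite degree and w has finite degree d.  By induction on r
-- we find r distinct neighbours y₁ … yᵣ of v and r distinct neighbours
-- s₁ … sᵣ of w such that yᵢ ↦ sᵢ is a homomorphism.  To extend, choose a new
-- neighbour y of v; then y ↦ w, yᵢ ↦ sᵢ is again a homomorphism, and any
-- endomorphism F extending it sends v to a vertex F v adjacent to w and to
-- every sᵢ, so F v is a new neighbour of w and y ↦ F v, yᵢ ↦ sᵢ is the next
-- stage.  At r = d + 1 this contradicts the degree of w.  Choosing y is only
-- possible up to double negation, which suffices since the goal is a negation.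
module Submission where

open import Defs
open import Data.Nat using (ℕ; zero; suc; _≤_)
open import Data.Nat.Properties using (_≟_; ≤⇒≯; n<1+n)
open import Data.Fin using (zero; suc)
open import Data.Fin.Properties using (injective⇒≤)
open import Data.Vec.Functional using (Vector; _∷_; toList)
open import Data.List using (List; length)
open import Data.List.Relation.Unary.Any using (index)
open import Data.List.Membership.Propositional using (_∈_; _∉_)
open import Data.List.Membership.Propositional.Properties using (∈-tabulate⁺)
open import Data.List.Membership.Setoid.Properties using (index-injective)
open import Data.List.Membership.DecPropositional _≟_ using (_∈?_)
open import Data.Product using (∃; Σ; _×_; _,_; proj₁; proj₂)
open import Data.Empty using (⊥-elim)
open import Function using (id)
open import Function.Definitions using (Injective)
open import Relation.Binary.PropositionalEquality using (_≡_; _≢_; refl; cong; subst; setoid)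
  renaming (sym to ≡-sym)
open import Relation.Nullary using (¬_)
open import Relation.Nullary.Decidable using (decidable-stable)

∷-injective : ∀ {A : Set} {n} {x : A} {f : Vector A n} →
  (∀ i → x ≢ f i) → Injective _≡_ _≡_ f → Injective _≡_ _≡_ (x ∷ f)
∷-injective x∉f f-inj {zero}  {zero}  _  = refl
∷-injective x∉f f-inj {zero}  {suc j} eq = ⊥-elim (x∉f j eq)
∷-injective x∉f f-inj {suc i} {zero}  eq = ⊥-elim (x∉f i (≡-sym eq))
∷-injective x∉f f-inj {suc i} {suc j} eq = cong suc (f-inj eq)

injective-into-list⇒≤length : ∀ {A : Set} {n} {f : Vector A n} (l : List A) →
  Injective _≡_ _≡_ f → (f∈l : ∀ i → f i ∈ l) → n ≤ length l
injective-into-list⇒≤length l f-inj f∈l =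
  injective⇒≤ (λ eq → f-inj (index-injective (setoid _) (f∈l _) (f∈l _) eq))

∉toList⇒≢ : ∀ {A : Set} {n} {x : A} (f : Vector A n) → x ∉ toList f → ∀ i → x ≢ f i
∉toList⇒≢ f x∉f i refl = x∉f (∈-tabulate⁺ i)

module _ (G : Graph) where

  adjacent⇒≢ : ∀ {x y} → E G x y → x ≢ y
  adjacent⇒≢ e refl = irrefl G e

  fresh-neighbour : ∀ {v} → InfiniteDegree G v → (l : List ℕ) →
    ¬ ¬ ∃ λ y → E G v y × y ∉ l
  fresh-neighbour infv l no-fresh = infv (l , λ y e →
    decidable-stable (y ∈? l) (λ y∉l → no-fresh (y , e , y∉l)))

  ∷-isFinHom : ∀ {n} {x y} {a b : Vector ℕ n} →
    (∀ i → E G x (a i) → E G y (b i)) → IsFinHom G a b id →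
    IsFinHom G (x ∷ a) (y ∷ b) id
  ∷-isFinHom x↦y a↦b zero    zero    e = ⊥-elim (irrefl G e)
  ∷-isFinHom x↦y a↦b zero    (suc j) e = x↦y j e
  ∷-isFinHom x↦y a↦b (suc i) zero    e = sym G (x↦y i (sym G e))
  ∷-isFinHom x↦y a↦b (suc i) (suc j) e = a↦b i j e

  record NeighbourMatching (v w r : ℕ) : Set where
    field
      source           : Vector ℕ r
      target           : Vector ℕ r
      source-injective : Injective _≡_ _≡_ source
      target-injective : Injective _≡_ _≡_ target
      source-adjacent  : ∀ i → E G v (source i)
      target-adjacent  : ∀ i → E G w (target i)
      homomorphism     : IsFinHom G source target id

  open NeighbourMatching

  empty-matching : ∀ {v w} → NeighbourMatching v w 0
  empty-matching = record
    { source = λ () ; target = λ ()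
    ; source-injective = λ { {()} } ; target-injective = λ { {()} }
    ; source-adjacent = λ () ; target-adjacent = λ () ; homomorphism = λ () }

  module _ (hh : HH-homogeneous G) {v w r : ℕ} (M : NeighbourMatching v w r)
           {y : ℕ} (v~y : E G v y) (y∉M : y ∉ toList (source M)) where

    private
      y≢source : ∀ i → y ≢ source M i
      y≢source = ∉toList⇒≢ (source M) y∉M

      extension : Σ (ℕ → ℕ) λ F → IsEndomorphism G F ×
                    (∀ i → F ((y ∷ source M) i) ≡ (w ∷ target M) i)
      extension = hh (suc r) (suc r) (y ∷ source M) (w ∷ target M)
        (∷-injective y≢source (source-injective M))
        (∷-injective (λ i → adjacent⇒≢ (target-adjacent M i)) (target-injective M))
        id
        (∷-isFinHom (λ i _ → target-adjacent M i) (homomorphism M))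

      F : ℕ → ℕ
      F = proj₁ extension

      F-endo : IsEndomorphism G F
      F-endo = proj₁ (proj₂ extension)

      F-extends : ∀ i → F ((y ∷ source M) i) ≡ (w ∷ target M) i
      F-extends = proj₂ (proj₂ extension)

      image-adjacent-to-target : ∀ i → E G (F v) (target M i)
      image-adjacent-to-target i =
        subst (E G (F v)) (F-extends (suc i)) (F-endo v (source M i) (source-adjacent M i))

      image-adjacent-to-w : E G w (F v)
      image-adjacent-to-w = sym G (subst (E G (F v)) (F-extends zero) (F-endo v y v~y))

    extend-matching : NeighbourMatching v w (suc r)
    extend-matching = record
      { source = y ∷ source M
      ; target = F v ∷ target M
      ; source-injective = ∷-injective y≢source (source-injective M)
      ; target-injective = ∷-injective (λ i → adjacent⇒≢ (image-adjacent-to-target i)) (target-injective M)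
      ; source-adjacent = λ { zero → v~y ; (suc i) → source-adjacent M i }
      ; target-adjacent = λ { zero → image-adjacent-to-w ; (suc i) → target-adjacent M i }
      ; homomorphism = ∷-isFinHom (λ i _ → image-adjacent-to-target i) (homomorphism M)
      }

  matchings-exist : HH-homogeneous G → ∀ {v w} → InfiniteDegree G v →
    ∀ r → ¬ ¬ NeighbourMatching v w r
  matchings-exist hh infv zero    no-matching = no-matching empty-matching
  matchings-exist hh infv (suc r) no-matching = matchings-exist hh infv r λ M →
    fresh-neighbour infv (toList (source M)) λ (y , v~y , y∉M) →
      no-matching (extend-matching hh M v~y y∉M)

  matching-size≤degree : ∀ {v w r} (l : List ℕ) → (∀ y → E G w y → y ∈ l) →
    NeighbourMatching v w r → r ≤ length l
  matching-size≤degree l w-nbrs⊆l M =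
    injective-into-list⇒≤length l (target-injective M)
      (λ i → w-nbrs⊆l (target M i) (target-adjacent M i))

proposition4 : (G : Graph) → HH-homogeneous G →
    ∃ (λ v → InfiniteDegree G v) → ∀ w → InfiniteDegree G w
proposition4 G hh (v , infv) w (l , w-nbrs⊆l) =
  matchings-exist G hh infv (suc (length l)) λ M →
    ≤⇒≯ (matching-size≤degree G l w-nbrs⊆l M) (n<1+n (length l))
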